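{- Let $n\ge 4$, and let $\beta$ be an integer satisfying $-2 \le 8\beta - 3n \le 2$. Then for every $X \subseteq E(H_\beta)$, $$|X|(8\beta - 3n) + t(X) + n(n-2\beta-1)(2\beta - n/2 + 1) \le n^3/16.$$
   Context: Take $n$ vertices arranged in a circle. For distinct vertices $u,v$ let $d(u,v)=1+|\{w: u,w,v \text{ distinct, in clockwise order}\}|$. $G_\beta$ is the digraph on these $n$ vertices with edge set $\{uv: 0<d(u,v)\le\beta\}$, and $H_\beta$ is its subgraph on the same vertex set with edge set $\{uv: d(u,v)=\beta\}$. For $X\subseteq E(H_\beta)$, $t(X)$ is the number of vertices of $H_\beta$ incident with exactly one edge of $X$. -}

module Defs where

import Data.Nat as ℕ
open import Data.Nat using (ℕ; _+_; _∸_; _≤ᵇ_)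
open import Data.Nat.Properties using () renaming (_≟_ to _≟ℕ_)
open import Data.Fin using (Fin; toℕ; zero; suc)
open import Data.Fin.Properties using (_≟_)
open import Data.Bool using (Bool; true; false; if_then_else_; _∧_; _∨_; not)
open import Data.Integer using (ℤ; +_)
open import Data.Product using (_×_)
open import Relation.Nullary using (¬_; does)
open import Relation.Binary.PropositionalEquality using (_≡_)

-- Vertices of the n-cycle are Fin n, placed at positions 0,1,…,n-1 in
-- clockwise order.

cwOffset : (n : ℕ) → Fin n → Fin n → ℕ
cwOffset n u w = if toℕ u ≤ᵇ toℕ w then toℕ w ∸ toℕ u else (n + toℕ w) ∸ toℕ u

cwOrder : (n : ℕ) → Fin n → Fin n → Fin n → Bool
cwOrder n u w v =
  not (does (u ≟ w)) ∧ not (does (w ≟ v)) ∧ not (does (u ≟ v))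
  ∧ (ℕ.suc (cwOffset n u w) ≤ᵇ cwOffset n u v)

sumFin : (n : ℕ) → (Fin n → ℕ) → ℕ
sumFin ℕ.zero f = 0
sumFin (ℕ.suc n) f = f zero + sumFin n (λ i → f (suc i))

countFin : (n : ℕ) → (Fin n → Bool) → ℕ
countFin n p = sumFin n (λ i → if p i then 1 else 0)

dist : (n : ℕ) → Fin n → Fin n → ℕ
dist n u v = ℕ.suc (countFin n (λ w → cwOrder n u w v))

IsEdgeH : (n : ℕ) → ℤ → Fin n → Fin n → Set
IsEdgeH n β u v = (¬ (u ≡ v)) × (+ dist n u v ≡ β)

-- A set X of (directed) edges, given by its characteristic function on
-- ordered pairs of vertices.
EdgeSet : ℕ → Set
EdgeSet n = Fin n → Fin n → Bool

edgeCount : (n : ℕ) → EdgeSet n → ℕ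
edgeCount n X = sumFin n (λ u → countFin n (λ v → X u v))

degX : (n : ℕ) → EdgeSet n → Fin n → ℕ
degX n X x = sumFin n (λ u → countFin n (λ v →
  X u v ∧ (does (x ≟ u) ∨ does (x ≟ v))))

tX : (n : ℕ) → EdgeSet n → ℕ
tX n X = countFin n (λ x → does (degX n X x ≟ℕ 1))

module Submission where

-- Write c = 8β − 3n.  Multiplied by 16, the claim reads
--   16c|X| + 16t(X) + 8n(n−2β−1)(4β−n+2) ≤ n³,
-- and since 8n(n−2β−1)(4β−n+2) = n³ − n(c+4)², it says 16c|X| + 16t(X) ≤ n(c+4)².
--
-- The combinatorial heart is that H_β has maximum in- and out-degree 1: the
-- distance d(u,v) grows strictly with the clockwise offset of v from u, and
-- shrinks strictly as u moves clockwise towards v, so no two edges of H_β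
-- share a tail or a head.  Hence every vertex x has degree deg(x) ≤ 2 in X,
-- the degrees sum to 2|X|, and t(X) counts the vertices with deg(x) = 1.
-- For d ∈ {0,1,2} and every integer c one has 8cd + 16[d = 1] ≤ (c+4)²
-- (the differences are (c+4)², c², (c−4)²); summing over the n vertices
-- gives the claim.

open import Defs
open import Data.Nat using (ℕ)
open import Data.Integer using (ℤ)

module CycleArithmetic where

  open import Data.Nat using (ℕ; zero; suc; _+_; _*_; _∸_; _<_; _≤ᵇ_)
  open import Data.Nat.Properties
  open import Algebra.Properties.CommutativeSemigroup +-commutativeSemigroup
    using (x∙yz≈y∙xz; xy∙z≈xz∙y)
  open import Data.Bool using (true; false; if_then_else_)
  open import Data.Empty using (⊥-elim)
  open import Data.Product using (_×_; _,_; ∃₂)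
  open import Relation.Nullary.Reflects using (ofʸ; ofⁿ)
  open import Relation.Binary.PropositionalEquality

  record Reaches (n o a b : ℕ) : Set where
    constructor _turns,_
    field
      turns : ℕ
      steps : o + a ≡ b + turns * n

  reaches-compose : ∀ {n x y a b c} →
    Reaches n x a c → Reaches n y c b → Reaches n (x + y) a b
  reaches-compose {n} {x} {y} {a} {b} {c} (k turns, x+a) (l turns, y+c) = (l + k) turns, (begin
    x + y + a           ≡⟨ cong (_+ a) (+-comm x y) ⟩
    y + x + a           ≡⟨ +-assoc y x a ⟩
    y + (x + a)         ≡⟨ cong (y +_) x+a ⟩
    y + (c + k * n)     ≡⟨ +-assoc y c (k * n) ⟨
    y + c + k * n       ≡⟨ cong (_+ k * n) y+c ⟩
    b + l * n + k * n   ≡⟨ +-assoc b (l * n) (k * n) ⟩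
    b + (l * n + k * n) ≡⟨ cong (b +_) (*-distribʳ-+ n l k) ⟨
    b + (l + k) * n     ∎)
    where open ≡-Reasoning

  reaches-difference : ∀ {n s z a b} → Reaches n s a b → Reaches n z a b →
    ∃₂ λ i j → s + i * n ≡ z + j * n
  reaches-difference {n} {s} {z} {a} {b} (k turns, s+a) (l turns, z+a) =
    l , k , +-cancelʳ-≡ a _ _ (begin
      s + l * n + a     ≡⟨ xy∙z≈xz∙y s (l * n) a ⟩
      s + a + l * n     ≡⟨ cong (_+ l * n) s+a ⟩
      b + k * n + l * n ≡⟨ xy∙z≈xz∙y b (k * n) (l * n) ⟩
      b + l * n + k * n ≡⟨ cong (_+ k * n) z+a ⟨
      z + a + k * n     ≡⟨ xy∙z≈xz∙y z a (k * n) ⟩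
      z + k * n + a     ∎)
    where open ≡-Reasoning

  -- For residues x, y, z < n, x + y ≡ z (mod n) means that the sum x + y
  -- wraps around the cycle at most once.
  data ModSum (n x y z : ℕ) : Set where
    no-wrap : x + y ≡ z → ModSum n x y z
    wrap    : x + y ≡ z + n → ModSum n x y z

  modSum-from-congruence : ∀ {n x y z} → x < n → y < n → z < n →
    ∀ i j → x + y + i * n ≡ z + j * n → ModSum n x y z
  modSum-from-congruence {n} {x} {y} {z} x<n y<n z<n = go
    where
    open ≤-Reasoning
    go : ∀ i j → x + y + i * n ≡ z + j * n → ModSum n x y z
    go zero zero e = no-wrap (trans (sym (+-identityʳ (x + y))) (trans e (+-identityʳ z)))
    go zero (suc zero) e = wrap (trans (sym (+-identityʳ (x + y))) (trans e (cong (z +_) (+-identityʳ n))))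
    go zero (suc (suc j)) e = ⊥-elim (<⇒≱ (+-mono-< x<n y<n) (begin
      n + n                   ≤⟨ +-monoʳ-≤ n (m≤m+n n (j * n)) ⟩
      n + (n + j * n)         ≤⟨ m≤n+m _ z ⟩
      z + (n + (n + j * n))   ≡⟨ e ⟨
      x + y + 0               ≡⟨ +-identityʳ (x + y) ⟩
      x + y                   ∎))
    go (suc i) zero e = ⊥-elim (<⇒≱ z<n (begin
      n                 ≤⟨ m≤m+n n (i * n) ⟩
      n + i * n         ≤⟨ m≤n+m _ (x + y) ⟩
      x + y + (n + i * n) ≡⟨ e ⟩
      z + 0             ≡⟨ +-identityʳ z ⟩
      z                 ∎))
    go (suc i) (suc j) e = go i j (+-cancelˡ-≡ n _ _ (begin-equality
      n + (x + y + i * n) ≡⟨ x∙yz≈y∙xz n (x + y) (i * n) ⟩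
      x + y + (n + i * n) ≡⟨ e ⟩
      z + (n + j * n)     ≡⟨ x∙yz≈y∙xz z n (j * n) ⟩
      n + (z + j * n)     ∎))

  modSum-comm : ∀ {n x y z} → ModSum n x y z → ModSum n y x z
  modSum-comm {x = x} {y} (no-wrap e) = no-wrap (trans (+-comm y x) e)
  modSum-comm {x = x} {y} (wrap e) = wrap (trans (+-comm y x) e)

  modSum-identity : ∀ {n x y} → y < n → ModSum n x y x → y ≡ 0
  modSum-identity {x = x} {y} _ (no-wrap e) = +-cancelˡ-≡ x y 0 (trans e (sym (+-identityʳ x)))
  modSum-identity {x = x} {y} y<n (wrap e) = ⊥-elim (<-irrefl (+-cancelˡ-≡ x y _ e) y<n)

  -- If x + y ≡ z (mod n) with 0 < x < z, the sum does not wrap, so y < z.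
  modSum-< : ∀ {n x y z} → y < n → ModSum n x y z → 0 < x → x < z → y < z
  modSum-< {x = x} {y} _ (no-wrap e) 0<x _ = subst (y <_) e (m<n+m y 0<x)
  modSum-< {x = x} {y} y<n (wrap e) _ x<z = ⊥-elim (<-irrefl e (+-mono-< x<z y<n))

  reaches-zero : ∀ {n a b} → a < n → Reaches n 0 a b → a ≡ b
  reaches-zero {b = b} _ (zero turns, e) = trans e (+-identityʳ b)
  reaches-zero {n} {a} {b} a<n (suc k turns, e) =
    ⊥-elim (<⇒≱ a<n (≤-trans (m≤m+n n (k * n)) (≤-trans (m≤n+m _ b) (≤-reflexive (sym e)))))

  position-offset : ∀ {n a b} → a < n → b < n →
    let o = if a ≤ᵇ b then b ∸ a else n + b ∸ a in o < n × Reaches n o a b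
  position-offset {n} {a} {b} a<n b<n with a ≤ᵇ b | ≤ᵇ-reflects-≤ a b
  ... | true  | ofʸ a≤b = ≤-<-trans (m∸n≤m b a) b<n
                        , 0 turns, trans (m∸n+n≡m a≤b) (sym (+-identityʳ b))
  ... | false | ofⁿ a≰b = +-cancelʳ-< a _ n (subst (_< n + a) (sym n+b∸a+a) (+-monoʳ-< n (≰⇒> a≰b)))
                        , 1 turns, trans n+b∸a+a (trans (+-comm n b) (cong (b +_) (sym (+-identityʳ n))))
    where
    n+b∸a+a : n + b ∸ a + a ≡ n + b
    n+b∸a+a = m∸n+n≡m (≤-trans (<⇒≤ a<n) (m≤m+n n b))

module ClockwiseOffsets (n : ℕ) where

  open CycleArithmetic
  open import Data.Nat using (_<_)
  open import Data.Nat.Properties using (<-irrefl; n≢0⇒n>0; ≤ᵇ⇒≤; ≤⇒≤ᵇ)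
  open import Data.Bool.Properties using (T-≡)
  open import Function using (_∘_; Equivalence)
  open import Data.Fin using (Fin; toℕ)
  open import Data.Fin.Properties using (toℕ<n; toℕ-injective; _≟_)
  open import Data.Bool using (true)
  open import Data.Empty using (⊥-elim)
  open import Data.Product using (_×_; _,_; proj₁; proj₂)
  open import Relation.Nullary using (¬_; yes; no)
  open import Relation.Binary.PropositionalEquality

  O : Fin n → Fin n → ℕ
  O = cwOffset n

  offset-< : ∀ u w → O u w < n
  offset-< u w = proj₁ (position-offset (toℕ<n u) (toℕ<n w))

  offset-reaches : ∀ u w → Reaches n (O u w) (toℕ u) (toℕ w)
  offset-reaches u w = proj₂ (position-offset (toℕ<n u) (toℕ<n w))

  offset-add : ∀ u w v → ModSum n (O u w) (O w v) (O u v)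
  offset-add u w v
    with reaches-difference (reaches-compose (offset-reaches u w) (offset-reaches w v))
                            (offset-reaches u v)
  ... | i , j , e = modSum-from-congruence (offset-< u w) (offset-< w v) (offset-< u v) i j e

  offset-zero : ∀ {u w} → O u w ≡ 0 → u ≡ w
  offset-zero {u} {w} e = toℕ-injective
    (reaches-zero (toℕ<n u) (subst (λ o → Reaches n o (toℕ u) (toℕ w)) e (offset-reaches u w)))

  offset-injectiveʳ : ∀ {u v v'} → O u v ≡ O u v' → v ≡ v'
  offset-injectiveʳ {u} {v} {v'} e = offset-zero (modSum-identity (offset-< v v')
    (subst (ModSum n (O u v) (O v v')) (sym e) (offset-add u v v')))

  offset-injectiveˡ : ∀ {u u' v} → O u v ≡ O u' v → u ≡ u'
  offset-injectiveˡ {u} {u'} {v} e = sym (offset-zero (modSum-identity (offset-< u' u)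
    (modSum-comm (subst (ModSum n (O u' u) (O u v)) (sym e) (offset-add u' u v)))))

  Between : Fin n → Fin n → Fin n → Set
  Between u w v = ¬ u ≡ w × ¬ w ≡ v × ¬ u ≡ v × O u w < O u v

  -- (When one of the three equality tests succeeds, cwOrder is false and the
  -- hypothesis is absurd, so those clauses are omitted.)
  cwOrder⇒Between : ∀ u w v → cwOrder n u w v ≡ true → Between u w v
  cwOrder⇒Between u w v h with u ≟ w | w ≟ v | u ≟ v
  ... | no u≢w | no w≢v | no u≢v = u≢w , w≢v , u≢v , ≤ᵇ⇒≤ _ _ (Equivalence.from T-≡ h)

  Between⇒cwOrder : ∀ u w v → Between u w v → cwOrder n u w v ≡ true
  Between⇒cwOrder u w v (u≢w , w≢v , u≢v , lt) with u ≟ w | w ≟ v | u ≟ v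
  ... | yes u≡w | _       | _       = ⊥-elim (u≢w u≡w)
  ... | no _    | yes w≡v | _       = ⊥-elim (w≢v w≡v)
  ... | no _    | no _    | yes u≡v = ⊥-elim (u≢v u≡v)
  ... | no _    | no _    | no _    = Equivalence.to T-≡ (≤⇒≤ᵇ lt)

  between-target : ∀ {u w v} → Between u w v → O w v < O u v
  between-target {u} {w} {v} (u≢w , _ , _ , lt) =
    modSum-< (offset-< w v) (offset-add u w v) (n≢0⇒n>0 (u≢w ∘ offset-zero)) lt

  target-between : ∀ {u w v} → ¬ w ≡ v → ¬ u ≡ v → O w v < O u v → Between u w v
  target-between {u} {w} {v} w≢v u≢v lt =
      (λ u≡w → <-irrefl (cong (λ x → O x v) (sym u≡w)) lt) , w≢v , u≢v
    , modSum-< (offset-< u w) (modSum-comm (offset-add u w v)) (n≢0⇒n>0 (w≢v ∘ offset-zero)) lt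

module FiniteSums where

  open import Data.Nat using (zero; suc; _+_; _≤_; _<_; z≤n; s≤s)
  open import Data.Nat.Properties
    using (+-0-commutativeMonoid; +-identityʳ; +-mono-≤; +-mono-<-≤; +-mono-≤-<; ≤-refl; ≤-reflexive)
  open import Algebra.Properties.CommutativeMonoid.Sum +-0-commutativeMonoid
    using (sum; ∑-distrib-+; ∑-comm)
  open import Data.Fin using (Fin; zero; suc)
  open import Data.Fin.Properties using (_≟_; suc-injective)
  open import Data.Bool using (Bool; true; false; if_then_else_; _∧_)
  open import Data.Empty using (⊥-elim)
  open import Relation.Nullary using (¬_; does)
  open import Relation.Binary.PropositionalEquality

  ι : Bool → ℕ
  ι b = if b then 1 else 0

  sumFin≡sum : ∀ n (f : Fin n → ℕ) → sumFin n f ≡ sum f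
  sumFin≡sum zero f = refl
  sumFin≡sum (suc n) f = cong (f zero +_) (sumFin≡sum n (λ i → f (suc i)))

  sumFin-cong : ∀ n {f g : Fin n → ℕ} → (∀ i → f i ≡ g i) → sumFin n f ≡ sumFin n g
  sumFin-cong zero _ = refl
  sumFin-cong (suc n) f≡g = cong₂ _+_ (f≡g zero) (sumFin-cong n (λ i → f≡g (suc i)))

  sumFin-zero : ∀ n → sumFin n (λ _ → 0) ≡ 0
  sumFin-zero zero = refl
  sumFin-zero (suc n) = sumFin-zero n

  sumFin-+ : ∀ n (f g : Fin n → ℕ) → sumFin n (λ i → f i + g i) ≡ sumFin n f + sumFin n g
  sumFin-+ n f g = begin
    sumFin n (λ i → f i + g i) ≡⟨ sumFin≡sum n _ ⟩
    sum (λ i → f i + g i)      ≡⟨ ∑-distrib-+ f g ⟩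
    sum f + sum g              ≡⟨ cong₂ _+_ (sumFin≡sum n f) (sumFin≡sum n g) ⟨
    sumFin n f + sumFin n g    ∎
    where open ≡-Reasoning

  sumFin-comm : ∀ m n (f : Fin m → Fin n → ℕ) →
    sumFin m (λ i → sumFin n (f i)) ≡ sumFin n (λ j → sumFin m (λ i → f i j))
  sumFin-comm m n f = begin
    sumFin m (λ i → sumFin n (f i))        ≡⟨ double m n f ⟩
    sum (λ i → sum (f i))                  ≡⟨ ∑-comm f ⟩
    sum (λ j → sum (λ i → f i j))          ≡⟨ double n m (λ j i → f i j) ⟨
    sumFin n (λ j → sumFin m (λ i → f i j)) ∎
    where
    open ≡-Reasoning
    double : ∀ m n (h : Fin m → Fin n → ℕ) → sumFin m (λ i → sumFin n (h i)) ≡ sum (λ i → sum (h i))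
    double m n h = trans (sumFin-cong m (λ i → sumFin≡sum n (h i))) (sumFin≡sum m _)

  sumFin-select : ∀ n (b : Fin n → Bool) (x : Fin n) →
    sumFin n (λ u → ι (does (x ≟ u) ∧ b u)) ≡ ι (b x)
  sumFin-select (suc n) b zero = trans (cong (ι (b zero) +_) (sumFin-zero n)) (+-identityʳ (ι (b zero)))
  sumFin-select (suc n) b (suc x) = sumFin-select n (λ i → b (suc i)) x

  sumFin-mono : ∀ n {f g : Fin n → ℕ} → (∀ i → f i ≤ g i) → sumFin n f ≤ sumFin n g
  sumFin-mono zero _ = z≤n
  sumFin-mono (suc n) f≤g = +-mono-≤ (f≤g zero) (sumFin-mono n (λ i → f≤g (suc i)))

  sumFin-< : ∀ n {f g : Fin n → ℕ} → (∀ i → f i ≤ g i) → ∀ i₀ → f i₀ < g i₀ →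
    sumFin n f < sumFin n g
  sumFin-< (suc n) f≤g zero lt = +-mono-<-≤ lt (sumFin-mono n (λ i → f≤g (suc i)))
  sumFin-< (suc n) f≤g (suc i₀) lt = +-mono-≤-< (f≤g zero) (sumFin-< n (λ i → f≤g (suc i)) i₀ lt)

  countFin-< : ∀ n (p q : Fin n → Bool) → (∀ w → p w ≡ true → q w ≡ true) →
    ∀ w₀ → ¬ p w₀ ≡ true → q w₀ ≡ true → countFin n p < countFin n q
  countFin-< n p q p⊆q w₀ w₀∉p w₀∈q = sumFin-< n ι-mono w₀ (ι-strict (p w₀) (q w₀) w₀∉p w₀∈q)
    where
    ι-mono : ∀ w → ι (p w) ≤ ι (q w)
    ι-mono w with p w | q w | p⊆q w
    ... | false | _     | _    = z≤n
    ... | true  | true  | _    = ≤-refl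
    ... | true  | false | p→q with p→q refl
    ...   | ()
    ι-strict : ∀ a b → ¬ a ≡ true → b ≡ true → ι a < ι b
    ι-strict false true _ _ = s≤s z≤n
    ι-strict true _ a≢true _ = ⊥-elim (a≢true refl)

  countFin-≤1 : ∀ n (p : Fin n → Bool) → (∀ i j → p i ≡ true → p j ≡ true → i ≡ j) →
    countFin n p ≤ 1
  countFin-≤1 zero p _ = z≤n
  countFin-≤1 (suc n) p unique with p zero in p₀
  ... | true  = ≤-reflexive (cong suc (trans (sumFin-cong n rest-off) (sumFin-zero n)))
    where
    rest-off : ∀ i → ι (p (suc i)) ≡ 0
    rest-off i with p (suc i) in pᵢ
    ... | false = refl
    ... | true  with unique zero (suc i) p₀ pᵢ
    ... | ()
  ... | false = countFin-≤1 n (λ i → p (suc i)) (λ i j pi pj → suc-injective (unique (suc i) (suc j) pi pj))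

module DegreesInH (n : ℕ) (β : ℤ) where

  open ClockwiseOffsets n
  open FiniteSums
  open import Data.Nat using (_+_; _≤_; _<_; s≤s)
  open import Data.Nat.Properties using (<-cmp; <-irrefl; <-trans; +-mono-≤)
  open import Data.Integer.Properties using (+-injective)
  open import Data.Fin using (Fin)
  open import Data.Fin.Properties using (_≟_)
  open import Data.Bool using (Bool; true; false; _∧_; _∨_)
  open import Data.Empty using (⊥; ⊥-elim)
  open import Data.Product using (_,_; proj₁; proj₂)
  open import Relation.Nullary using (¬_; does; yes; no)
  open import Relation.Binary.Definitions using (tri<; tri≈; tri>)
  open import Relation.Binary.PropositionalEquality

  strictMono-injective : ∀ {P : Fin n → Set} (f g : Fin n → ℕ) →
    (∀ {a b} → g a ≡ g b → a ≡ b) →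
    (∀ {a b} → P a → P b → g a < g b → f a < f b) →
    ∀ {a b} → P a → P b → f a ≡ f b → a ≡ b
  strictMono-injective f g g-inj mono {a} {b} pa pb fa≡fb with <-cmp (g a) (g b)
  ... | tri< lt _ _ = ⊥-elim (<-irrefl fa≡fb (mono pa pb lt))
  ... | tri≈ _ eq _ = g-inj eq
  ... | tri> _ _ gt = ⊥-elim (<-irrefl (sym fa≡fb) (mono pb pa gt))

  -- d(u,v) grows strictly with the clockwise offset of v from u: the arc to
  -- the nearer target lies inside the arc to the farther one, which also
  -- contains the nearer target itself.
  dist-out-< : ∀ {u v v'} → ¬ u ≡ v → ¬ u ≡ v' → O u v < O u v' → dist n u v < dist n u v'
  dist-out-< {u} {v} {v'} u≢v u≢v' lt = s≤s (countFin-< n _ _ grow v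
      (λ h → proj₁ (proj₂ (cwOrder⇒Between u v v h)) refl)
      (Between⇒cwOrder u v v' (u≢v , v≢v' , u≢v' , lt)))
    where
    v≢v' : ¬ v ≡ v'
    v≢v' v≡v' = <-irrefl (cong (O u) v≡v') lt
    grow : ∀ w → cwOrder n u w v ≡ true → cwOrder n u w v' ≡ true
    grow w h with cwOrder⇒Between u w v h
    ... | u≢w , _ , _ , uw<uv = Between⇒cwOrder u w v'
      (u≢w , (λ w≡v' → <-irrefl (cong (O u) w≡v') (<-trans uw<uv lt)) , u≢v' , <-trans uw<uv lt)

  dist-in-< : ∀ {u u' v} → ¬ u ≡ v → ¬ u' ≡ v → O u' v < O u v → dist n u' v < dist n u v
  dist-in-< {u} {u'} {v} u≢v u'≢v lt = s≤s (countFin-< n _ _ grow u'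
      (λ h → proj₁ (cwOrder⇒Between u' u' v h) refl)
      (Between⇒cwOrder u u' v (target-between u'≢v u≢v lt)))
    where
    grow : ∀ w → cwOrder n u' w v ≡ true → cwOrder n u w v ≡ true
    grow w h with cwOrder⇒Between u' w v h
    ... | b@(_ , w≢v , _ , _) = Between⇒cwOrder u w v
      (target-between w≢v u≢v (<-trans (between-target b) lt))

  edge-dist : ∀ {u v u' v'} → IsEdgeH n β u v → IsEdgeH n β u' v' → dist n u v ≡ dist n u' v'
  edge-dist (_ , d≡β) (_ , d'≡β) = +-injective (trans d≡β (sym d'≡β))

  H-out-unique : ∀ {u v v'} → IsEdgeH n β u v → IsEdgeH n β u v' → v ≡ v'
  H-out-unique {u} uv uv' = strictMono-injective {P = λ v → ¬ u ≡ v} (dist n u) (O u)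
    (offset-injectiveʳ {u}) dist-out-< (proj₁ uv) (proj₁ uv') (edge-dist uv uv')

  H-in-unique : ∀ {u u' v} → IsEdgeH n β u v → IsEdgeH n β u' v → u ≡ u'
  H-in-unique {v = v} uv u'v = strictMono-injective {P = λ u → ¬ u ≡ v} (λ u → dist n u v) (λ u → O u v)
    (offset-injectiveˡ {v = v}) (λ a≢v b≢v → dist-in-< b≢v a≢v) (proj₁ uv) (proj₁ u'v) (edge-dist uv u'v)

  ι-split : ∀ b p q → (b ≡ true → p ≡ true → q ≡ true → ⊥) →
    ι (b ∧ (p ∨ q)) ≡ ι (p ∧ b) + ι (q ∧ b)
  ι-split false false false _ = refl
  ι-split false false true  _ = refl
  ι-split false true  false _ = refl
  ι-split false true  true  _ = refl
  ι-split true  false false _ = refl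
  ι-split true  false true  _ = refl
  ι-split true  true  false _ = refl
  ι-split true  true  true  both = ⊥-elim (both refl refl refl)

  module Degrees (X : EdgeSet n) (X⊆H : ∀ u v → X u v ≡ true → IsEdgeH n β u v) where

    outDeg inDeg : Fin n → ℕ
    outDeg x = countFin n (X x)
    inDeg  x = countFin n (λ u → X u x)

    outDeg-≤1 : ∀ x → outDeg x ≤ 1
    outDeg-≤1 x = countFin-≤1 n (X x) (λ v v' xv xv' → H-out-unique (X⊆H x v xv) (X⊆H x v' xv'))

    inDeg-≤1 : ∀ x → inDeg x ≤ 1
    inDeg-≤1 x = countFin-≤1 n (λ u → X u x) (λ u u' ux u'x → H-in-unique (X⊆H u x ux) (X⊆H u' x u'x))

    -- X has no loops, so each edge at x is counted once, as outgoing or incoming.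
    degX-split : ∀ x → degX n X x ≡ outDeg x + inDeg x
    degX-split x = begin
      sumFin n (λ u → sumFin n (λ v → ι (X u v ∧ (x≟ u ∨ x≟ v))))
        ≡⟨ sumFin-cong n (λ u → sumFin-cong n (λ v → ι-split (X u v) (x≟ u) (x≟ v) (no-loop u v))) ⟩
      sumFin n (λ u → sumFin n (λ v → ι (x≟ u ∧ X u v) + ι (x≟ v ∧ X u v)))
        ≡⟨ sumFin-cong n (λ u → sumFin-+ n _ _) ⟩
      sumFin n (λ u → sumFin n (λ v → ι (x≟ u ∧ X u v)) + sumFin n (λ v → ι (x≟ v ∧ X u v)))
        ≡⟨ sumFin-+ n _ _ ⟩
      sumFin n (λ u → sumFin n (λ v → ι (x≟ u ∧ X u v)))
        + sumFin n (λ u → sumFin n (λ v → ι (x≟ v ∧ X u v)))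
        ≡⟨ cong₂ _+_ (trans (sumFin-comm n n _) (sumFin-cong n (λ v → sumFin-select n (λ u → X u v) x)))
                     (sumFin-cong n (λ u → sumFin-select n (X u) x)) ⟩
      outDeg x + inDeg x ∎
      where
      open ≡-Reasoning
      x≟_ : Fin n → Bool
      x≟ u = does (x ≟ u)
      no-loop : ∀ u v → X u v ≡ true → x≟ u ≡ true → x≟ v ≡ true → ⊥
      no-loop u v uv with x ≟ u | x ≟ v
      ... | yes refl | yes refl = λ _ _ → proj₁ (X⊆H x x uv) refl
      ... | yes _    | no _     = λ _ ()
      ... | no _     | _        = λ ()

    degree-≤2 : ∀ x → degX n X x ≤ 2
    degree-≤2 x = subst (_≤ 2) (sym (degX-split x)) (+-mono-≤ (outDeg-≤1 x) (inDeg-≤1 x))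

    handshake : sumFin n (degX n X) ≡ edgeCount n X + edgeCount n X
    handshake = begin
      sumFin n (degX n X)                 ≡⟨ sumFin-cong n degX-split ⟩
      sumFin n (λ x → outDeg x + inDeg x) ≡⟨ sumFin-+ n outDeg inDeg ⟩
      edgeCount n X + sumFin n inDeg      ≡⟨ cong (edgeCount n X +_) (sumFin-comm n n (λ x u → ι (X u x))) ⟩
      edgeCount n X + edgeCount n X       ∎
      where open ≡-Reasoning

module VertexWeights where

  open FiniteSums using (ι)
  open import Data.Nat as ℕ using (ℕ; zero; suc; s≤s; z≤n)
  open import Data.Nat.Properties using (_≟_)
  open import Data.Integer using (ℤ; +_; -[1+_]; _+_; _-_; _*_; _≤_; +≤+)
  open import Data.Integer.Properties using (pos-+; pos-*; +-mono-≤; +-monoʳ-≤; +-identityʳ; ≤-reflexive)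
  open import Data.Integer.Tactic.RingSolver using (solve-∀)
  open import Data.Fin using (Fin) renaming (zero to fzero; suc to fsuc)
  open import Relation.Nullary using (does)
  open import Relation.Binary.PropositionalEquality

  square-nonneg : ∀ i → + 0 ≤ i * i
  square-nonneg (+ m)    = subst (+ 0 ≤_) (pos-* m m) (+≤+ z≤n)
  square-nonneg -[1+ m ] = +≤+ z≤n

  ≤-by-square : ∀ a b s → b ≡ a + s * s → a ≤ b
  ≤-by-square a b s b≡a+s² = subst₂ _≤_ (+-identityʳ a) (sym b≡a+s²) (+-monoʳ-≤ a (square-nonneg s))

  -- The weight 8c·d + 16·[d = 1] of a vertex of degree d ≤ 2 is at most
  -- (c + 4)², for every integer c: the differences are (c + 4)², c², (c − 4)².
  vertex-bound : ∀ c d → d ℕ.≤ 2 →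
    + 8 * c * + d + + 16 * + ι (does (d ≟ 1)) ≤ (c + + 4) * (c + + 4)
  vertex-bound c 0 _ = ≤-by-square _ _ (c + + 4) (degree0 c)
    where
    degree0 : ∀ c → (c + + 4) * (c + + 4) ≡ + 8 * c * + 0 + + 16 * + 0 + (c + + 4) * (c + + 4)
    degree0 = solve-∀
  vertex-bound c 1 _ = ≤-by-square _ _ c (degree1 c)
    where
    degree1 : ∀ c → (c + + 4) * (c + + 4) ≡ + 8 * c * + 1 + + 16 * + 1 + c * c
    degree1 = solve-∀
  vertex-bound c 2 _ = ≤-by-square _ _ (c - + 4) (degree2 c)
    where
    degree2 : ∀ c → (c + + 4) * (c + + 4) ≡ + 8 * c * + 2 + + 16 * + 0 + (c - + 4) * (c - + 4)
    degree2 = solve-∀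
  vertex-bound c (suc (suc (suc d))) (s≤s (s≤s ()))

  weighted-sum-≤ : ∀ n (a b k : ℤ) (f g : Fin n → ℕ) → (∀ i → a * + f i + b * + g i ≤ k) →
    a * + sumFin n f + b * + sumFin n g ≤ k * + n
  weighted-sum-≤ zero a b k f g _ = ≤-reflexive (empty a b k)
    where
    empty : ∀ a b k → a * + 0 + b * + 0 ≡ k * + 0
    empty = solve-∀
  weighted-sum-≤ (suc n) a b k f g bound = begin
    a * + (f fzero ℕ.+ F) + b * + (g fzero ℕ.+ G)
      ≡⟨ cong₂ (λ x y → a * x + b * y) (pos-+ (f fzero) F) (pos-+ (g fzero) G) ⟩
    a * (+ f fzero + + F) + b * (+ g fzero + + G)
      ≡⟨ regroup a b (+ f fzero) (+ F) (+ g fzero) (+ G) ⟩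
    (a * + f fzero + b * + g fzero) + (a * + F + b * + G)
      ≤⟨ +-mono-≤ (bound fzero) (weighted-sum-≤ n a b k (λ i → f (fsuc i)) (λ i → g (fsuc i)) (λ i → bound (fsuc i))) ⟩
    k + k * + n
      ≡⟨ one-more k (+ n) ⟩
    k * (+ 1 + + n)
      ≡⟨ cong (k *_) (pos-+ 1 n) ⟨
    k * + suc n ∎
    where
    open Data.Integer.Properties.≤-Reasoning
    F G : ℕ
    F = sumFin n (λ i → f (fsuc i))
    G = sumFin n (λ i → g (fsuc i))
    regroup : ∀ a b x x' y y' → a * (x + x') + b * (y + y') ≡ (a * x + b * y) + (a * x' + b * y')
    regroup = solve-∀
    one-more : ∀ k m → k + k * m ≡ k * (+ 1 + m)
    one-more = solve-∀

open import Data.Nat using (_≤_)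
open import Data.Nat.Properties using (_≟_)
open import Data.Fin using (Fin)
open import Data.Bool using (true)
open import Data.Integer using (+_; -_; _+_; _-_; _*_) renaming (_≤_ to _≤ℤ_)
open import Data.Integer.Properties using (pos-+; +-monoˡ-≤; module ≤-Reasoning)
open import Data.Integer.Tactic.RingSolver using (solve-∀)
open import Relation.Binary.PropositionalEquality using (_≡_; sym; trans; cong)
open import Relation.Nullary using (does)
open FiniteSums using (ι)
open VertexWeights using (vertex-bound; weighted-sum-≤)

-- The scaled inequality rewritten in terms of c = 8β − 3n and the degree sum
-- 2|X| = |X| + |X|.
scaled-form : ∀ (E T n β : ℤ) → let c = + 8 * β - + 3 * n in
  + 16 * E * c + + 16 * T + + 8 * n * (n - + 2 * β - + 1) * (+ 4 * β - n + + 2)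
    ≡ + 8 * c * (E + E) + + 16 * T + (n * n * n - (c + + 4) * (c + + 4) * n)
scaled-form = solve-∀

cancel-slack : ∀ (k m : ℤ) → k * m + (m * m * m - k * m) ≡ m * m * m
cancel-slack = solve-∀

lemma3p15 : (n : ℕ) → 4 ≤ n → (β : ℤ)
    → - + 2 ≤ℤ + 8 * β - + 3 * + n → + 8 * β - + 3 * + n ≤ℤ + 2
    → (X : EdgeSet n) → (∀ u v → X u v ≡ true → IsEdgeH n β u v)
    → + 16 * + edgeCount n X * (+ 8 * β - + 3 * + n) + + 16 * + tX n X
        + + 8 * + n * (+ n - + 2 * β - + 1) * (+ 4 * β - + n + + 2)
      ≤ℤ + n * + n * + n
lemma3p15 n _ β _ _ X X⊆H = begin
  + 16 * + E * c + + 16 * + tX n X + + 8 * + n * (+ n - + 2 * β - + 1) * (+ 4 * β - + n + + 2)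
    ≡⟨ scaled-form (+ E) (+ tX n X) (+ n) β ⟩
  + 8 * c * (+ E + + E) + + 16 * + tX n X + slack
    ≡⟨ cong (λ m → + 8 * c * m + + 16 * + tX n X + slack) (trans (sym (pos-+ E E)) (cong +_ (sym handshake))) ⟩
  + 8 * c * + sumFin n (degX n X) + + 16 * + tX n X + slack
    ≤⟨ +-monoˡ-≤ slack (weighted-sum-≤ n (+ 8 * c) (+ 16) ((c + + 4) * (c + + 4)) (degX n X) leaf
                         (λ x → vertex-bound c (degX n X x) (degree-≤2 x))) ⟩
  (c + + 4) * (c + + 4) * + n + slack
    ≡⟨ cancel-slack ((c + + 4) * (c + + 4)) (+ n) ⟩
  + n * + n * + n ∎
  where
  open ≤-Reasoning
  open DegreesInH.Degrees n β X X⊆H using (handshake; degree-≤2)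
  E : ℕ
  E = edgeCount n X
  c : ℤ
  c = + 8 * β - + 3 * + n
  slack : ℤ
  slack = + n * + n * + n - (c + + 4) * (c + + 4) * + n
  leaf : Fin n → ℕ
  leaf x = ι (does (degX n X x ≟ 1))
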